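{- Let $K$ be a simplicial complex, let $f:V(K)\to\mathbb{Z}$ be an injective vertex map with induced stack $F$, and let $V[1],\dots,V[N]$ be the vertices of $K$ listed so that $f(V[i])<f(V[j])$ whenever $i<j$. For each $i\in[1,N]$, let $S_i=\hat{\delta}(V[i])$ be the lower star of $V[i]$ (a cosimplicial complex), and let $W_i=\mathbf{Max}(S_i,\mathbb{1}_{S_i})$ be the output of the procedure described below applied to $S_i$ with the constant stack $\mathbb{1}_{S_i}$ (value $1$ everywhere) and an enumeration of $S_i$ by non-decreasing dimension. Let $W=W_1\cdot W_2\cdots W_N$ be the concatenation. Then $W$ is a simplex-wise Morse sequence on $K$ (i.e. from $\emptyset$ to $K$), and for each $i$, $W_i$ is a maximal simplex-wise Morse sequence on $S_i$ (maximal for the constant stack $\mathbb{1}_{S_i}$). Procedure $\mathbf{Max}(S,F)$, for a cosimplicial complex $S$ with $N'=|S|$, a stack $F$ on $S$ and an enumeration $S[1],\dots,S[N']$ with $F(S[i])\le F(S[j])$ for $i<j$ and $\dim S[i]\le\dim S[j]$ when $F(S[i])=F(S[j])$: set $i:=1$, $T:=\emptyset$, $U:=\emptyset$, $W:=\langle\,\rangle$; for each $\tau\in S$ set $\rho(\tau):=|\partial(\tau,S)|$ and add $\tau$ to $U$ if $\rho(\tau)=1$. While $i\le N'$: (a) while $U\ne\emptyset$, remove any $\tau$ from $U$; if $\rho(\tau)=1$, let $\sigma$ be the element of $\partial(\tau,S)$ not in $T$; if $F(\tau)=F(\sigma)$, append $(\sigma,\tau)$ to $W$, set $T:=T\cup\{\sigma,\tau\}$,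 and for each $\mu\in\delta(\sigma,S)\cup\delta(\tau,S)$ decrease $\rho(\mu)$ by 1 and add $\mu$ to $U$ if $\rho(\mu)=1$; (b) while $i\le N'$ and $S[i]\in T$, set $i:=i+1$; (c) if $i\le N'$, let $\sigma:=S[i]$, add $\sigma$ to $T$, append $\sigma$ to $W$, and for each $\tau\in\delta(\sigma,S)$ decrease $\rho(\tau)$ by 1 and add $\tau$ to $U$ if $\rho(\tau)=1$. Return $W$.
   Context: A simplicial complex is a finite family of non-empty finite sets (simplexes) closed under taking non-empty subsets; $\dim(\sigma)=|\sigma|-1$; $V(K)$ is the set of $0$-dimensional faces. For $\sigma\in K$: $\partial(\sigma,K)=\{\mu\in K:\mu\subseteq\sigma,\dim\mu=\dim\sigma-1\}$, $\delta(\sigma,K)=\{\mu\in K:\sigma\subseteq\mu,\dim\mu=\dim\sigma+1\}$. A pair $(\sigma,\tau)$, $\sigma\subsetneq\tau$, is a free pair for $K$ if $\tau$ is the only face of $K$ other than $\sigma$ containing $\sigma$; then $K$ is an elementary expansion of $K\setminus\{\sigma,\tau\}$. If $\nu$ is a maximal face of $K$, $K$ is an elementary filling of $K\setminus\{\nu\}$. The stack induced by $f$ is $F(\tau)=\max\{f(\sigma):\sigma\in V(K),\sigma\subseteq\tau\}$; the lower star of a vertex $\sigma$ is $\hat\delta(\sigma)=\{\tau\in K:\sigma\subseteq\tau, F(\tau)=F(\sigma)\}$. A finite set $S$ of simplexes is a cosimplicial complex if $\nu\in S$ whenever $\sigma\subseteq\nu\subseteq\tau$ with $\sigma,\tau\in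 S$; $\overline{S}$ is the set of simplexes contained in some element of $S$, $\underline{S}=\overline{S}\setminus S$; for $\nu\in S$, $\partial(\nu,S)=\partial(\nu,\overline{S})\cap S$, $\delta(\nu,S)=\delta(\nu,\overline{S})$. A stack on $S$ is $F:S\to\mathbb{Z}$ with $F(\sigma)\le F(\tau)$ whenever $\sigma\subseteq\tau$. A Morse sequence from $L$ to $K$ is a sequence $\langle L=K_0,\dots,K_k=K\rangle$ of simplicial complexes, each $K_i$ an elementary expansion or elementary filling of $K_{i-1}$; its simplex-wise form is $\langle\kappa_1,\dots,\kappa_k\rangle$ with $\kappa_i=\nu$ if $K_i=K_{i-1}\cup\{\nu\}$ is a filling and $\kappa_i=(\sigma,\tau)$ if $K_i=K_{i-1}\cup\{\sigma,\tau\}$ is an expansion with free pair $(\sigma,\tau)$. A Morse sequence on $K$ is one from $\emptyset$ to $K$; a Morse sequence on a cosimplicial $S$ is one from $\underline{S}$ to $\overline{S}$. A Morse sequence $\langle K_0,\dots,K_k\rangle$ on $S$ is maximal for a stack $F$ (with all regular pairs $(\sigma,\tau)$ satisfying $F(\sigma)=F(\tau)$) if for every $i$ such that $K_i$ is a filling of $K_{i-1}$, no pair $\sigma,\tau\in S\setminus K_{i-1}$ with $F(\sigma)=F(\tau)$ makes $K_{i-1}\cup\{\sigma,\tau\}$ an elementary expansion of $K_{i-1}$; "maximal" without qualification means maximal for the constant stack. -}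

module Defs where

open import Level using (0ℓ)
open import Data.Nat using (ℕ; zero; suc; _∸_; _≡ᵇ_) renaming (_≤_ to _≤ℕ_)
open import Data.Integer using (ℤ; _⊔_; _≤_; _<_)
open import Data.Bool using (Bool; true; false; _∧_; _∨_; if_then_else_; not)
open import Data.Fin using (Fin)
open import Data.Fin.Subset using (Subset; _∈_; _⊆_; _⊂_; ∣_∣; Nonempty; ⁅_⁆)
open import Data.Fin.Subset.Properties using (_⊆?_; _∈?_)
open import Data.Vec.Properties using (≡-dec)
import Data.Bool.Properties as BoolP
open import Data.List using (List; []; _∷_; _++_; [_]; foldr; map; filterᵇ; length; allFin; concatMap)
open import Data.Bool.ListAction using (any)
open import Data.List.Relation.Unary.AllPairs using (AllPairs)
open import Data.List.Relation.Unary.Unique.Propositional using (Unique)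
open import Data.Maybe using (Maybe; just; nothing)
open import Data.Product using (Σ; ∃; _×_; _,_; proj₁; proj₂)
open import Data.Sum using (_⊎_)
open import Data.Empty using (⊥)
open import Relation.Nullary using (¬_; does)
open import Relation.Binary.PropositionalEquality using (_≡_; _≢_)
open import Relation.Binary.Definitions using (DecidableEquality)
open import Function.Bundles using (_⇔_)
import Data.List.Membership.DecPropositional as DecMem

-- Simplexes are (non-empty) subsets of the vertex universe Fin n.
-- Families of simplexes are predicates on Subset n (finite automatically).

Fam : ℕ → Set₁
Fam n = Subset n → Set

⟦_⟧ : ∀ {n} → (Subset n → Bool) → Fam n
⟦ K ⟧ σ = K σ ≡ true

∅F : ∀ {n} → Fam n
∅F _ = ⊥

_≐_ : ∀ {n} → Fam n → Fam n → Set
A ≐ B = ∀ σ → A σ ⇔ B σ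

_≟S_ : ∀ {n} → DecidableEquality (Subset n)
_≟S_ = ≡-dec BoolP._≟_

IsComplex : ∀ {n} → Fam n → Set
IsComplex C = (∀ σ → C σ → Nonempty σ)
            × (∀ σ τ → C τ → Nonempty σ → σ ⊆ τ → C σ)

IsMaximalFace : ∀ {n} → Fam n → Subset n → Set
IsMaximalFace C ν = C ν × (∀ τ → C τ → ν ⊆ τ → τ ≡ ν)

IsFreePair : ∀ {n} → Fam n → Subset n → Subset n → Set
IsFreePair C σ τ = σ ⊂ τ × C σ × C τ
                 × (∀ μ → C μ → σ ⊆ μ → μ ≢ σ → μ ≡ τ)

data Step (n : ℕ) : Set where
  fill : Subset n → Step n
  pair : Subset n → Subset n → Step n

_⊕_ : ∀ {n} → Fam n → Step n → Fam n
(C ⊕ fill ν) x = C x ⊎ x ≡ ν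
(C ⊕ pair σ τ) x = C x ⊎ (x ≡ σ ⊎ x ≡ τ)

ElemStep : ∀ {n} → Fam n → Step n → Set
ElemStep C (fill ν) =
  ¬ C ν × IsComplex (C ⊕ fill ν) × IsMaximalFace (C ⊕ fill ν) ν
ElemStep C (pair σ τ) =
  ¬ C σ × ¬ C τ × IsComplex (C ⊕ pair σ τ) × IsFreePair (C ⊕ pair σ τ) σ τ

Steps : ∀ {n} → Fam n → List (Step n) → Fam n → Set
Steps C []       D = C ≐ D
Steps C (s ∷ ss) D = ElemStep C s × Steps (C ⊕ s) ss D

MorseSeqFrom : ∀ {n} → Fam n → List (Step n) → Fam n → Set
MorseSeqFrom L W K = IsComplex L × Steps L W K

Closure : ∀ {n} → Fam n → Fam n
Closure S σ = Nonempty σ × ∃ λ τ → S τ × σ ⊆ τ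

LowerClosure : ∀ {n} → Fam n → Fam n
LowerClosure S σ = Closure S σ × ¬ S σ

MorseSeqOn : ∀ {n} → Fam n → List (Step n) → Set
MorseSeqOn S W = MorseSeqFrom (LowerClosure S) W (Closure S)

-- maximality for a stack F (on S).  The filling steps are the positions
-- i with K_i a filling of K_{i-1}; C is K_{i-1}.
MaximalFrom : ∀ {n} → Fam n → (Subset n → ℤ) → Fam n → List (Step n) → Set
MaximalFrom S F C [] = Data.Unit.⊤ where import Data.Unit
MaximalFrom S F C (fill ν ∷ ss) =
  (¬ ∃ λ σ → ∃ λ τ → S σ × S τ × F σ ≡ F τ × ElemStep C (pair σ τ))
  × MaximalFrom S F (C ⊕ fill ν) ss
MaximalFrom S F C (pair σ τ ∷ ss) = F σ ≡ F τ × MaximalFrom S F (C ⊕ pair σ τ) ss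

MaximalMorseSeqOn : ∀ {n} → Fam n → (Subset n → ℤ) → List (Step n) → Set
MaximalMorseSeqOn S F W = MorseSeqOn S W × MaximalFrom S F (LowerClosure S) W

IsVertex : ∀ {n} → (Subset n → Bool) → Fin n → Set
IsVertex K v = K ⁅ v ⁆ ≡ true

maxList : List ℤ → Maybe ℤ
maxList []       = nothing
maxList (x ∷ xs) = just (foldr _⊔_ x xs)

inducedStack : ∀ {n} → (Subset n → Bool) → (Fin n → ℤ) → Subset n → Maybe ℤ
inducedStack {n} K f τ =
  maxList (map f (filterᵇ (λ v → does (v ∈? τ) ∧ K ⁅ v ⁆) (allFin n)))

LowerStar : ∀ {n} → (Subset n → Bool) → (Fin n → ℤ) → Fin n → Fam n
LowerStar K f v τ =
  K τ ≡ true × ⁅ v ⁆ ⊆ τ × inducedStack K f τ ≡ inducedStack K f ⁅ v ⁆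

VertexListing : ∀ {n} → (Subset n → Bool) → (Fin n → ℤ) → List (Fin n) → Set
VertexListing K f Vs =
  (∀ v → (v Data.List.Membership.Propositional.∈ Vs) ⇔ IsVertex K v)
  × AllPairs (λ a b → f a < f b) Vs
  where import Data.List.Membership.Propositional

InjectiveOnVertices : ∀ {n} → (Subset n → Bool) → (Fin n → ℤ) → Set
InjectiveOnVertices K f = ∀ v w → IsVertex K v → IsVertex K w → f v ≡ f w → v ≡ w

constStack : ∀ {n} → Subset n → ℤ
constStack _ = Data.Integer.+ 1 where import Data.Integer

module _ {n : ℕ} where
  open DecMem (_≟S_ {n}) using () renaming (_∈_ to _∈L_)

  ValidEnum : (Subset n → ℤ) → Fam n → List (Subset n) → Set
  ValidEnum F S Sl =
    Unique Sl × (∀ σ → (σ ∈L Sl) ⇔ S σ)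
    × AllPairs (λ a b → F a ≤ F b × (F a ≡ F b → ∣ a ∣ ≤ℕ ∣ b ∣)) Sl

-- The procedure Max(S , F) as a (nondeterministic) relational semantics.
-- S is given by its enumeration Sl = S[1..N'].

record State (n : ℕ) : Set where
  constructor st
  field
    rest : List (Subset n)     -- S[i..N']  (i ≤ N' iff rest non-empty)
    T    : Subset n → Bool
    U    : Subset n → Bool
    ρ    : Subset n → ℕ
    W    : List (Step n)

countᵇ : ∀ {A : Set} → (A → Bool) → List A → ℕ
countᵇ p xs = length (filterᵇ p xs)

module Procedure {n : ℕ} (Sl : List (Subset n)) (F : Subset n → ℤ) where
  open DecMem (_≟S_ {n}) using () renaming (_∈?_ to _∈L?_)

  inS : Subset n → Bool
  inS x = does (x ∈L? Sl)

  -- membership in S̄ (elements of S are non-empty, so any μ ⊇ σ ∈ S is non-empty)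
  inSbar : Subset n → Bool
  inSbar μ = any (λ τ → does (μ ⊆? τ)) Sl

  -- μ ∈ δ(σ , S) = δ(σ , S̄)
  inδ : Subset n → Subset n → Bool
  inδ σ μ = inSbar μ ∧ does (σ ⊆? μ) ∧ (∣ μ ∣ ≡ᵇ suc ∣ σ ∣)

  inB : Subset n → Subset n → Bool
  inB τ μ = inS μ ∧ does (μ ⊆? τ) ∧ (suc ∣ μ ∣ ≡ᵇ ∣ τ ∣)

  ρ₀ : Subset n → ℕ
  ρ₀ τ = countᵇ (inB τ) Sl

  initial : State n
  initial = st Sl (λ _ → false) (λ τ → inS τ ∧ (ρ₀ τ ≡ᵇ 1)) ρ₀ []

  decr : (Subset n → Bool) → (Subset n → ℕ) → Subset n → ℕ
  decr D ρ μ = if D μ then ρ μ ∸ 1 else ρ μ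

  addU : (Subset n → Bool) → (Subset n → ℕ) → (Subset n → Bool) → Subset n → Bool
  addU D ρ' U μ = U μ ∨ (D μ ∧ (ρ' μ ≡ᵇ 1))

  remove : (Subset n → Bool) → Subset n → Subset n → Bool
  remove U τ μ = U μ ∧ not (does (μ ≟S τ))

  insert : (Subset n → Bool) → Subset n → Subset n → Bool
  insert T σ μ = T μ ∨ does (μ ≟S σ)

  open State

  dropU : State n → Subset n → State n
  dropU s τ = record s { U = remove (U s) τ }

  doPair : State n → Subset n → Subset n → State n
  doPair s σ τ =
    let D  = λ μ → inδ σ μ ∨ inδ τ μ
        ρ' = decr D (ρ s)
    in record s { T = insert (insert (T s) σ) τ
                ; U = addU D ρ' (remove (U s) τ)
                ; ρ = ρ'
                ; W = W s ++ [ pair σ τ ] }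

  doFill : State n → Subset n → State n
  doFill s σ =
    let D  = inδ σ
        ρ' = decr D (ρ s)
    in record s { T = insert (T s) σ
                ; U = addU D ρ' (U s)
                ; ρ = ρ'
                ; W = W s ++ [ fill σ ] }

  -- Loop s W : starting at the test of the outer while-loop in state s,
  -- the procedure can return W.  PhA/PhB/PhC: at the start of (a)/(b)/(c).
  data Loop : State n → List (Step n) → Set
  data PhA  : State n → List (Step n) → Set
  data PhB  : State n → List (Step n) → Set
  data PhC  : State n → List (Step n) → Set

  data Loop where
    loop-exit : ∀ {s} → rest s ≡ [] → Loop s (W s)
    loop-go   : ∀ {s x r out} → rest s ≡ x ∷ r → PhA s out → Loop s out

  data PhA where
    a-exit  : ∀ {s out} → (∀ μ → U s μ ≡ false) → PhB s out → PhA s out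
    a-skip  : ∀ {s τ out} → U s τ ≡ true → ρ s τ ≢ 1 →
              PhA (dropU s τ) out → PhA s out
    a-noeq  : ∀ {s τ σ out} → U s τ ≡ true → ρ s τ ≡ 1 →
              inB τ σ ≡ true → T s σ ≡ false → F τ ≢ F σ →
              PhA (dropU s τ) out → PhA s out
    a-pair  : ∀ {s τ σ out} → U s τ ≡ true → ρ s τ ≡ 1 →
              inB τ σ ≡ true → T s σ ≡ false → F τ ≡ F σ →
              PhA (doPair s σ τ) out → PhA s out

  data PhB where
    b-skip : ∀ {s x r out} → rest s ≡ x ∷ r → T s x ≡ true →
             PhB (record s { rest = r }) out → PhB s out
    b-end  : ∀ {s out} → rest s ≡ [] → PhC s out → PhB s out
    b-stop : ∀ {s x r out} → rest s ≡ x ∷ r → T s x ≡ false →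
             PhC s out → PhB s out

  data PhC where
    c-none : ∀ {s out} → rest s ≡ [] → Loop s out → PhC s out
    c-fill : ∀ {s x r out} → rest s ≡ x ∷ r →
             Loop (doFill s x) out → PhC s out

  MaxRun : List (Step n) → Set
  MaxRun out = Loop initial out

{-# OPTIONS --safe #-}

-- Along a run of Max on S, the complex built so far is C ∪ T, where C is what precedes S
-- (the lower closure of S, or the simplexes of K with no vertex in V[i..N]) and T is the set
-- of simplexes of S already added; ρ τ counts the facets of τ in S outside T.  A pair (σ, τ)
-- is added only when σ is the only such facet, and convexity of S then puts every other face
-- of τ in C ∪ T, so (σ, τ) is a free pair.  A filled simplex is the first unmarked one of a
-- dimension-sorted enumeration, so its proper faces are present and it is a maximal face.
-- Fillings happen only when U is empty, while a free pair (σ, τ) would force ρ τ = 1 and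
-- τ ∈ U: this is maximality.  Globally, the simplexes of K with no vertex in V[i..N] together
-- with the lower star of V[i] are those with no vertex in V[i+1..N], so the concatenation
-- builds K from ∅.

module Submission where

open import Defs
open import Data.Bool using (Bool; true; false; _∧_; _∨_; not; T?)
open import Data.Bool.Properties using (not-injective; ∧-zeroʳ; ∧-identityʳ; ∨-zeroʳ; ¬-not; not-¬; ⇔→≡; T-≡)
open import Data.Empty using (⊥-elim)
open import Data.Fin using (Fin)
import Data.Fin as Fin
open import Data.Fin.Properties using (¬∀⟶∃¬)
open import Data.Fin.Subset using (Subset; _∈_; _∉_; _⊆_; _⊂_; ∣_∣; _-_; ⁅_⁆; Nonempty; inside; outside)
open import Data.Fin.Subset.Properties
  using ( _⊆?_; _∈?_; ⊆-refl; ⊆-trans; ⊆-antisym; p⊂q⇒∣p∣<∣q∣; p─⊥≡p; p─q⊆p; x∈p∧x≢y⇒x∈p-y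
        ; x∈⁅x⁆; x∈⁅y⁆⇒x≡y)
open import Data.Integer using (ℤ; _⊔_) renaming (_≤_ to _≤ℤ_; _<_ to _<ℤ_)
import Data.Integer.Properties as ℤ
open import Data.List using (List; []; _∷_; _++_; [_]; map; foldr; filterᵇ; allFin; concatMap)
open import Data.List.Properties using (++-assoc; ++-identityʳ; ∷-injectiveˡ)
open import Data.List.Membership.Propositional using (find; lose) renaming (_∈_ to _∈L_)
open import Data.List.Membership.Propositional.Properties
  using (∈-++⁻; ∈-++⁺ʳ; ∈-filter⁺; ∈-filter⁻; ∈-allFin; ∈-map⁺; ∈-map⁻)
import Data.List.Membership.DecPropositional as DecMembership
open import Data.List.Relation.Binary.Pointwise using (Pointwise; []; _∷_)
import Data.List.Relation.Binary.Pointwise as Pointwise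
open import Data.List.Relation.Unary.All using (All; []; _∷_)
import Data.List.Relation.Unary.All as All
open import Data.List.Relation.Unary.All.Properties using () renaming (++⁺ to All++⁺)
open import Data.List.Relation.Unary.AllPairs using (AllPairs; []; _∷_)
import Data.List.Relation.Unary.AllPairs as AllPairs
open import Data.List.Relation.Unary.Any using (here; there)
open import Data.List.Relation.Unary.Any.Properties using (any⁺; any⁻)
open import Data.List.Relation.Unary.Unique.Propositional using (Unique)
open import Data.Maybe using (just)
open import Data.Nat using (ℕ; suc; _≤_; _≤?_; _∸_; _≡ᵇ_)
open import Data.Nat.Properties using (≡ᵇ⇒≡; ≡⇒≡ᵇ; <-irrefl; ≤-trans; 1+n≢n; ≰⇒>; suc-injective)
open import Data.Product using (∃; _×_; _,_; proj₁; proj₂)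
import Data.Product as Product
open import Data.Sum using (_⊎_; inj₁; inj₂)
import Data.Sum as Sum
import Data.Vec as Vec
open import Function.Base using (_∘_; case_of_)
open import Function.Bundles using (_⇔_; mk⇔; Equivalence)
open import Function.Properties.Equivalence using () renaming (sym to ⇔-sym; trans to ⇔-trans)
open import Relation.Binary.Definitions using (DecidableEquality)
open import Relation.Binary.PropositionalEquality
  using (_≡_; _≢_; refl; sym; trans; cong; cong₂; subst; module ≡-Reasoning)
open import Relation.Nullary using (¬_; Dec; yes; no; does)
open import Relation.Nullary.Decidable using (_→-dec_; dec-true; dec-false)
import Relation.Nullary.Decidable as Dec

does⇒ : ∀ {A : Set} (a? : Dec A) → does a? ≡ true → A
does⇒ (yes a) _ = a
does⇒ (no _)  ()

∧-true⁻ : ∀ {a b} → a ∧ b ≡ true → a ≡ true × b ≡ true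
∧-true⁻ {true} {true} _ = refl , refl

∨-true⁻ : ∀ {a b} → a ∨ b ≡ true → a ≡ true ⊎ b ≡ true
∨-true⁻ {true}  _ = inj₁ refl
∨-true⁻ {false} e = inj₂ e

∨-trueˡ : ∀ {a} b → a ≡ true → a ∨ b ≡ true
∨-trueˡ b refl = refl

∨-trueʳ : ∀ a {b} → b ≡ true → a ∨ b ≡ true
∨-trueʳ a refl = ∨-zeroʳ a

≡ᵇ-true⁻ : ∀ {m n} → (m ≡ᵇ n) ≡ true → m ≡ n
≡ᵇ-true⁻ {m} {n} e = ≡ᵇ⇒≡ m n (Equivalence.from T-≡ e)

≡ᵇ-true⁺ : ∀ {m n} → m ≡ n → (m ≡ᵇ n) ≡ true
≡ᵇ-true⁺ {m} {n} e = Equivalence.to T-≡ (≡⇒≡ᵇ m n e)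

module _ {n : ℕ} where

  ⊈⇒∃∉ : {p q : Subset n} → ¬ p ⊆ q → ∃ λ x → x ∈ p × x ∉ q
  ⊈⇒∃∉ {p} {q} p⊈q
    with ¬∀⟶∃¬ n (λ x → x ∈ p → x ∈ q) (λ x → x ∈? p →-dec x ∈? q) (λ h → p⊈q (h _))
  ... | x , ¬x∈p⇒x∈q with x ∈? p
  ...   | yes x∈p = x , x∈p , λ x∈q → ¬x∈p⇒x∈q (λ _ → x∈q)
  ...   | no  x∉p = ⊥-elim (¬x∈p⇒x∈q (λ x∈p → ⊥-elim (x∉p x∈p)))

  ⊆∧≢⇒⊂ : {p q : Subset n} → p ⊆ q → p ≢ q → p ⊂ q
  ⊆∧≢⇒⊂ p⊆q p≢q with ⊈⇒∃∉ (λ q⊆p → p≢q (⊆-antisym p⊆q q⊆p))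
  ... | x , x∈q , x∉p = p⊆q , x , x∈q , x∉p

  ⊆∧∣≥∣⇒≡ : {p q : Subset n} → p ⊆ q → ∣ q ∣ ≤ ∣ p ∣ → p ≡ q
  ⊆∧∣≥∣⇒≡ {p} {q} p⊆q ∣q∣≤∣p∣ with p ≟S q
  ... | yes p≡q = p≡q
  ... | no  p≢q =
    ⊥-elim (<-irrefl refl (≤-trans (p⊂q⇒∣p∣<∣q∣ (⊆∧≢⇒⊂ p⊆q p≢q)) ∣q∣≤∣p∣))

x∈p⇒suc∣p-x∣≡∣p∣ : ∀ {n} {p : Subset n} {x} → x ∈ p → suc ∣ p - x ∣ ≡ ∣ p ∣
x∈p⇒suc∣p-x∣≡∣p∣ {p = inside Vec.∷ p}  Vec.here      = cong (λ q → suc ∣ q ∣) (p─⊥≡p p)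
x∈p⇒suc∣p-x∣≡∣p∣ {p = inside Vec.∷ p}  (Vec.there h) = cong suc (x∈p⇒suc∣p-x∣≡∣p∣ h)
x∈p⇒suc∣p-x∣≡∣p∣ {p = outside Vec.∷ p} (Vec.there h) = x∈p⇒suc∣p-x∣≡∣p∣ h

x∉p-x : ∀ {n} (p : Subset n) x → x ∉ p - x
x∉p-x (_ Vec.∷ p) Fin.zero    ()
x∉p-x (_ Vec.∷ p) (Fin.suc x) (Vec.there h) = x∉p-x p x h

infix 4 _⋖_

_⋖_ : ∀ {n} → Subset n → Subset n → Set
σ ⋖ τ = σ ⊆ τ × suc ∣ σ ∣ ≡ ∣ τ ∣

module _ {n : ℕ} where

  ⋖⇒≢ : {σ τ : Subset n} → σ ⋖ τ → σ ≢ τ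
  ⋖⇒≢ (_ , e) refl = 1+n≢n e

  x∈p⇒p-x⋖p : {p : Subset n} {x : Fin n} → x ∈ p → p - x ⋖ p
  x∈p⇒p-x⋖p {p} x∈p = p─q⊆p p _ , x∈p⇒suc∣p-x∣≡∣p∣ x∈p

  ⋖-between : {σ ν τ : Subset n} → σ ⋖ τ → σ ⊆ ν → ν ⊆ τ → ν ≡ σ ⊎ ν ≡ τ
  ⋖-between {σ} {ν} (_ , ∣τ∣≡) σ⊆ν ν⊆τ with ∣ ν ∣ ≤? ∣ σ ∣
  ... | yes ∣ν∣≤∣σ∣ = inj₁ (sym (⊆∧∣≥∣⇒≡ σ⊆ν ∣ν∣≤∣σ∣))
  ... | no  ∣ν∣≰∣σ∣ = inj₂ (⊆∧∣≥∣⇒≡ ν⊆τ (subst (_≤ ∣ ν ∣) ∣τ∣≡ (≰⇒> ∣ν∣≰∣σ∣)))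

  ⋖-avoiding : {σ ν τ : Subset n} → σ ⋖ τ → ν ⊆ τ → ¬ σ ⊆ ν →
               ∃ λ ρ → ρ ⋖ τ × ν ⊆ ρ × ρ ≢ σ
  ⋖-avoiding {σ} {ν} {τ} (σ⊆τ , _) ν⊆τ σ⊈ν with ⊈⇒∃∉ σ⊈ν
  ... | w , w∈σ , w∉ν =
    τ - w , x∈p⇒p-x⋖p (σ⊆τ w∈σ) ,
    (λ x∈ν → x∈p∧x≢y⇒x∈p-y (ν⊆τ x∈ν) (λ { refl → w∉ν x∈ν })) ,
    (λ τ-w≡σ → x∉p-x τ w (subst (w ∈_) (sym τ-w≡σ) w∈σ))

  ⊂∧no-between⇒⋖ : {σ τ : Subset n} → σ ⊂ τ →
                   (∀ ν → σ ⊆ ν → ν ⊆ τ → ν ≢ σ → ν ≡ τ) → σ ⋖ τ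
  ⊂∧no-between⇒⋖ {σ} {τ} (σ⊆τ , w , w∈τ , w∉σ) between with (τ - w) ≟S σ
  ... | yes τ-w≡σ = subst (_⋖ τ) τ-w≡σ (x∈p⇒p-x⋖p w∈τ)
  ... | no  τ-w≢σ = ⊥-elim (x∉p-x τ w (subst (w ∈_) (sym τ-w≡τ) w∈τ))
    where
    σ⊆τ-w : σ ⊆ τ - w
    σ⊆τ-w x∈σ = x∈p∧x≢y⇒x∈p-y (σ⊆τ x∈σ) (λ { refl → w∉σ x∈σ })
    τ-w≡τ : τ - w ≡ τ
    τ-w≡τ = between (τ - w) σ⊆τ-w (p─q⊆p τ _) τ-w≢σ

AllPairs-dropˡ : ∀ {A : Set} {R : A → A → Set} xs {ys} → AllPairs R (xs ++ ys) → AllPairs R ys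
AllPairs-dropˡ []       Rys        = Rys
AllPairs-dropˡ (_ ∷ xs) (_ ∷ Rxys) = AllPairs-dropˡ xs Rxys

module Counting {A : Set} (_≟_ : DecidableEquality A) where

  _without_ : (A → Bool) → A → A → Bool
  (p without a) y = p y ∧ not (does (y ≟ a))

  without-self : ∀ p a → (p without a) a ≡ false
  without-self p a rewrite dec-true (a ≟ a) refl = ∧-zeroʳ (p a)

  without-≢ : ∀ p {a y} → y ≢ a → (p without a) y ≡ p y
  without-≢ p {a} {y} y≢a rewrite dec-false (y ≟ a) y≢a = ∧-identityʳ (p y)

  without-false : ∀ p {a} y → p a ≡ false → (p without a) y ≡ p y
  without-false p {a} y pa with y ≟ a
  ... | yes refl = trans (∧-zeroʳ (p a)) (sym pa)
  ... | no  _    = ∧-identityʳ (p y)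

  countᵇ-cong : ∀ {p q} (xs : List A) → (∀ {x} → x ∈L xs → p x ≡ q x) → countᵇ p xs ≡ countᵇ q xs
  countᵇ-cong []                 _ = refl
  countᵇ-cong {p} {q} (x ∷ xs) h with p x | q x | h (here refl)
  ... | true  | true  | _ = cong suc (countᵇ-cong xs (h ∘ there))
  ... | false | false | _ = countᵇ-cong xs (h ∘ there)

  countᵇ≡0 : ∀ {p} (xs : List A) → (∀ {x} → x ∈L xs → p x ≡ false) → countᵇ p xs ≡ 0
  countᵇ≡0 []                 _ = refl
  countᵇ≡0 {p} (x ∷ xs) h with p x | h (here refl)
  ... | false | _ = countᵇ≡0 xs (h ∘ there)

  countᵇ≢0 : ∀ {p y} (xs : List A) → y ∈L xs → p y ≡ true → countᵇ p xs ≢ 0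
  countᵇ≢0 {p} (x ∷ xs) (here refl) px rewrite px = λ ()
  countᵇ≢0 {p} (x ∷ xs) (there y∈)  py with p x
  ... | true  = λ ()
  ... | false = countᵇ≢0 xs y∈ py

  countᵇ-∷-suc : ∀ p q {x} (xs : List A) → p x ≡ q x → countᵇ p xs ≡ suc (countᵇ q xs) →
                 countᵇ p (x ∷ xs) ≡ suc (countᵇ q (x ∷ xs))
  countᵇ-∷-suc p q {x} xs px≡qx h with p x | q x
  ... | true  | true  = cong suc h
  ... | false | false = h
  ... | true  | false = ⊥-elim (not-¬ (sym px≡qx) refl)
  ... | false | true  = ⊥-elim (not-¬ px≡qx refl)

  countᵇ-∷-head : ∀ p q {x} (xs : List A) → p x ≡ true → q x ≡ false → countᵇ p xs ≡ countᵇ q xs →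
                  countᵇ p (x ∷ xs) ≡ suc (countᵇ q (x ∷ xs))
  countᵇ-∷-head p q {x} xs px qx h with p x | q x | px | qx
  ... | true | false | _ | _ = cong suc h

  countᵇ-without : ∀ p {a} {xs : List A} → Unique xs → a ∈L xs → p a ≡ true →
                   countᵇ p xs ≡ suc (countᵇ (p without a) xs)
  countᵇ-without p {a} {a ∷ xs} (a∉xs ∷ _) (here refl) pa =
    countᵇ-∷-head p (p without a) {a} xs pa (without-self p a)
      (countᵇ-cong xs (λ {y} y∈xs → sym (without-≢ p {a} {y} (All.lookup a∉xs y∈xs ∘ sym))))
  countᵇ-without p {a} {x ∷ xs} (x∉xs ∷ u) (there a∈xs) pa =
    countᵇ-∷-suc p (p without a) {x} xs (sym (without-≢ p {a} {x} (All.lookup x∉xs a∈xs)))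
      (countᵇ-without p u a∈xs pa)

  countᵇ≡1⇒≡ : ∀ {p a b} {xs : List A} → Unique xs → countᵇ p xs ≡ 1 →
               a ∈L xs → b ∈L xs → p a ≡ true → p b ≡ true → a ≡ b
  countᵇ≡1⇒≡ {p} {a} {b} {xs} u count≡1 a∈ b∈ pa pb with b ≟ a
  ... | yes b≡a = sym b≡a
  ... | no  b≢a = ⊥-elim (countᵇ≢0 xs b∈ (trans (without-≢ p b≢a) pb)
                    (suc-injective (trans (sym (countᵇ-without p u a∈ pa)) count≡1)))

  countᵇ≡1 : ∀ {p a} {xs : List A} → Unique xs → a ∈L xs → p a ≡ true →
             (∀ {y} → y ∈L xs → p y ≡ true → y ≡ a) → countᵇ p xs ≡ 1
  countᵇ≡1 {p} {a} {xs} u a∈ pa only =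
    trans (countᵇ-without p u a∈ pa) (cong suc (countᵇ≡0 xs no-other))
    where
    no-other : ∀ {y} → y ∈L xs → (p without a) y ≡ false
    no-other {y} y∈ with y ≟ a
    ... | yes refl = ∧-zeroʳ (p a)
    ... | no  y≢a  = trans (∧-identityʳ (p y)) (¬-not (y≢a ∘ only y∈))

module _ {n : ℕ} where

  ∅-isComplex : IsComplex (∅F {n})
  ∅-isComplex = (λ _ ()) , (λ _ _ ())

  _∪ᶠ_ : Fam n → Fam n → Fam n
  (A ∪ᶠ B) σ = A σ ⊎ B σ

  ≐⇒ : {A B : Fam n} → A ≐ B → ∀ {σ} → A σ → B σ
  ≐⇒ A≐B {σ} = Equivalence.to (A≐B σ)

  ≐-sym : {A B : Fam n} → A ≐ B → B ≐ A
  ≐-sym A≐B σ = ⇔-sym (A≐B σ)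

  ≐-trans : {A B C : Fam n} → A ≐ B → B ≐ C → A ≐ C
  ≐-trans A≐B B≐C σ = ⇔-trans (A≐B σ) (B≐C σ)

  ⊕-cong : {A B : Fam n} (s : Step n) → A ≐ B → (A ⊕ s) ≐ (B ⊕ s)
  ⊕-cong (fill _)   A≐B σ = mk⇔ (Sum.map₁ (≐⇒ A≐B)) (Sum.map₁ (≐⇒ (≐-sym A≐B)))
  ⊕-cong (pair _ _) A≐B σ = mk⇔ (Sum.map₁ (≐⇒ A≐B)) (Sum.map₁ (≐⇒ (≐-sym A≐B)))

  IsComplex-cong : {A B : Fam n} → A ≐ B → IsComplex A → IsComplex B
  IsComplex-cong A≐B (nonempty , closed) =
    (λ σ → nonempty σ ∘ ≐⇒ (≐-sym A≐B)) ,
    (λ σ τ Bτ → λ σ≠∅ σ⊆τ → ≐⇒ A≐B (closed σ τ (≐⇒ (≐-sym A≐B) Bτ) σ≠∅ σ⊆τ))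

  ElemStep-cong : {A B : Fam n} (s : Step n) → A ≐ B → ElemStep A s → ElemStep B s
  ElemStep-cong {A} {B} (fill ν) A≐B (ν∉A , complex , Aν , maximal) =
    ν∉A ∘ ≐⇒ (≐-sym A≐B) , IsComplex-cong A⊕≐B⊕ complex ,
    ≐⇒ A⊕≐B⊕ Aν , (λ τ → maximal τ ∘ ≐⇒ (≐-sym A⊕≐B⊕))
    where
    A⊕≐B⊕ : (A ⊕ fill ν) ≐ (B ⊕ fill ν)
    A⊕≐B⊕ = ⊕-cong (fill ν) A≐B
  ElemStep-cong {A} {B} (pair σ τ) A≐B (σ∉A , τ∉A , complex , σ⊂τ , Aσ , Aτ , free) =
    σ∉A ∘ ≐⇒ (≐-sym A≐B) , τ∉A ∘ ≐⇒ (≐-sym A≐B) , IsComplex-cong A⊕≐B⊕ complex ,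
    σ⊂τ , ≐⇒ A⊕≐B⊕ Aσ , ≐⇒ A⊕≐B⊕ Aτ , (λ μ → free μ ∘ ≐⇒ (≐-sym A⊕≐B⊕))
    where
    A⊕≐B⊕ : (A ⊕ pair σ τ) ≐ (B ⊕ pair σ τ)
    A⊕≐B⊕ = ⊕-cong (pair σ τ) A≐B

  Steps-congˡ : {A B D : Fam n} (ss : List (Step n)) → A ≐ B → Steps A ss D → Steps B ss D
  Steps-congˡ []       A≐B A≐D          = ≐-trans (≐-sym A≐B) A≐D
  Steps-congˡ (s ∷ ss) A≐B (step , rest) = ElemStep-cong s A≐B step , Steps-congˡ ss (⊕-cong s A≐B) rest

  Steps-congʳ : {A D E : Fam n} (ss : List (Step n)) → D ≐ E → Steps A ss D → Steps A ss E
  Steps-congʳ []       D≐E A≐D          = ≐-trans A≐D D≐E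
  Steps-congʳ (s ∷ ss) D≐E (step , rest) = step , Steps-congʳ ss D≐E rest

  Steps-++ : {A B D : Fam n} (ss ts : List (Step n)) → Steps A ss B → Steps B ts D → Steps A (ss ++ ts) D
  Steps-++ []       ts A≐B          B→D = Steps-congˡ ts (≐-sym A≐B) B→D
  Steps-++ (s ∷ ss) ts (step , rest) B→D = step , Steps-++ ss ts rest B→D

  MaximalFrom-cong : {S A B : Fam n} {F : Subset n → ℤ} (ss : List (Step n)) →
                     A ≐ B → MaximalFrom S F A ss → MaximalFrom S F B ss
  MaximalFrom-cong []              A≐B _                  = _
  MaximalFrom-cong (fill ν ∷ ss)   A≐B (no-pair , rest)  =
    (λ (σ , τ , Sσ , Sτ , Fσ≡Fτ , step) →
       no-pair (σ , τ , Sσ , Sτ , Fσ≡Fτ , ElemStep-cong (pair σ τ) (≐-sym A≐B) step)) ,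
    MaximalFrom-cong ss (⊕-cong (fill ν) A≐B) rest
  MaximalFrom-cong (pair σ τ ∷ ss) A≐B (Fσ≡Fτ , rest)   =
    Fσ≡Fτ , MaximalFrom-cong ss (⊕-cong (pair σ τ) A≐B) rest

  fill-elemStep : {C : Fam n} {ν : Subset n} → IsComplex C → ¬ C ν → Nonempty ν →
                  (∀ μ → Nonempty μ → μ ⊆ ν → μ ≢ ν → C μ) → ElemStep C (fill ν)
  fill-elemStep {C} {ν} (nonempty , closed) ν∉C ν≠∅ faces =
    ν∉C , (nonempty′ , closed′) , inj₂ refl , maximal
    where
    nonempty′ : ∀ μ → (C ⊕ fill ν) μ → Nonempty μ
    nonempty′ μ (inj₁ Cμ)   = nonempty μ Cμ
    nonempty′ μ (inj₂ refl) = ν≠∅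
    closed′ : ∀ μ κ → (C ⊕ fill ν) κ → Nonempty μ → μ ⊆ κ → (C ⊕ fill ν) μ
    closed′ μ κ (inj₁ Cκ)   μ≠∅ μ⊆κ = inj₁ (closed μ κ Cκ μ≠∅ μ⊆κ)
    closed′ μ κ (inj₂ refl) μ≠∅ μ⊆ν with μ ≟S ν
    ... | yes μ≡ν = inj₂ μ≡ν
    ... | no  μ≢ν = inj₁ (faces μ μ≠∅ μ⊆ν μ≢ν)
    maximal : ∀ κ → (C ⊕ fill ν) κ → ν ⊆ κ → κ ≡ ν
    maximal κ (inj₁ Cκ)  ν⊆κ = ⊥-elim (ν∉C (closed ν κ Cκ ν≠∅ ν⊆κ))
    maximal κ (inj₂ κ≡ν) _   = κ≡ν

  pair-elemStep : {C : Fam n} {σ τ : Subset n} → IsComplex C → ¬ C σ → Nonempty σ → σ ⊂ τ →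
                  (∀ μ → Nonempty μ → μ ⊆ τ → μ ≢ σ → μ ≢ τ → C μ) → ElemStep C (pair σ τ)
  pair-elemStep {C} {σ} {τ} (nonempty , closed) σ∉C σ≠∅@(x , x∈σ) σ⊂τ@(σ⊆τ , _) faces =
    σ∉C , τ∉C , (nonempty′ , closed′) , σ⊂τ , inj₂ (inj₁ refl) , inj₂ (inj₂ refl) , free
    where
    τ∉C : ¬ C τ
    τ∉C Cτ = σ∉C (closed σ τ Cτ σ≠∅ σ⊆τ)
    face-of-τ : ∀ μ → Nonempty μ → μ ⊆ τ → (C ⊕ pair σ τ) μ
    face-of-τ μ μ≠∅ μ⊆τ with μ ≟S σ | μ ≟S τ
    ... | yes μ≡σ | _       = inj₂ (inj₁ μ≡σ)
    ... | no  _   | yes μ≡τ = inj₂ (inj₂ μ≡τ)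
    ... | no  μ≢σ | no  μ≢τ = inj₁ (faces μ μ≠∅ μ⊆τ μ≢σ μ≢τ)
    nonempty′ : ∀ μ → (C ⊕ pair σ τ) μ → Nonempty μ
    nonempty′ μ (inj₁ Cμ)          = nonempty μ Cμ
    nonempty′ μ (inj₂ (inj₁ refl)) = σ≠∅
    nonempty′ μ (inj₂ (inj₂ refl)) = x , σ⊆τ x∈σ
    closed′ : ∀ μ κ → (C ⊕ pair σ τ) κ → Nonempty μ → μ ⊆ κ → (C ⊕ pair σ τ) μ
    closed′ μ κ (inj₁ Cκ)          μ≠∅ μ⊆κ = inj₁ (closed μ κ Cκ μ≠∅ μ⊆κ)
    closed′ μ κ (inj₂ (inj₁ refl)) μ≠∅ μ⊆σ = face-of-τ μ μ≠∅ (⊆-trans μ⊆σ σ⊆τ)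
    closed′ μ κ (inj₂ (inj₂ refl)) μ≠∅ μ⊆τ = face-of-τ μ μ≠∅ μ⊆τ
    free : ∀ μ → (C ⊕ pair σ τ) μ → σ ⊆ μ → μ ≢ σ → μ ≡ τ
    free μ (inj₁ Cμ)          σ⊆μ _   = ⊥-elim (σ∉C (closed σ μ Cμ σ≠∅ σ⊆μ))
    free μ (inj₂ (inj₁ μ≡σ))  _   μ≢σ = ⊥-elim (μ≢σ μ≡σ)
    free μ (inj₂ (inj₂ μ≡τ))  _   _   = μ≡τ

record Extension {n : ℕ} (C S : Fam n) : Set where
  field
    isComplex     : IsComplex C
    nonempty      : ∀ σ → S σ → Nonempty σ
    faces         : ∀ σ τ → S τ → Nonempty σ → σ ⊆ τ → C σ ⊎ S σ
    star-disjoint : ∀ σ μ → S σ → σ ⊆ μ → ¬ C μ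

  S∩C≡∅ : ∀ {σ} → S σ → ¬ C σ
  S∩C≡∅ {σ} Sσ = star-disjoint σ σ Sσ ⊆-refl

  convex : ∀ {σ μ τ} → S σ → σ ⊆ μ → μ ⊆ τ → S τ → S μ
  convex {σ} {μ} {τ} Sσ σ⊆μ μ⊆τ Sτ
    with faces μ τ Sτ (Product.map₂ σ⊆μ (nonempty σ Sσ)) μ⊆τ
  ... | inj₁ Cμ = ⊥-elim (star-disjoint σ μ Sσ σ⊆μ Cμ)
  ... | inj₂ Sμ = Sμ

module MaxCorrectness {n : ℕ} {C S : Fam n} (ext : Extension C S)
                      {Sl : List (Subset n)} (enum : ValidEnum constStack S Sl) where

  open Extension ext
  open Procedure Sl constStack
  open State
  open Counting (_≟S_ {n})
  open DecMembership (_≟S_ {n}) using () renaming (_∈?_ to _∈Sl?_)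
  open ≡-Reasoning

  unique : Unique Sl
  unique = proj₁ enum

  ∈Sl⇒S : ∀ {σ} → σ ∈L Sl → S σ
  ∈Sl⇒S {σ} = Equivalence.to (proj₁ (proj₂ enum) σ)

  S⇒∈Sl : ∀ {σ} → S σ → σ ∈L Sl
  S⇒∈Sl {σ} = Equivalence.from (proj₁ (proj₂ enum) σ)

  sorted : AllPairs (λ σ τ → ∣ σ ∣ ≤ ∣ τ ∣) Sl
  sorted = AllPairs.map (λ (_ , same-stack⇒≤) → same-stack⇒≤ refl) (proj₂ (proj₂ enum))

  inS-true⁻ : ∀ {σ} → inS σ ≡ true → S σ
  inS-true⁻ {σ} e = ∈Sl⇒S (does⇒ (σ ∈Sl? Sl) e)

  inS-true⁺ : ∀ {σ} → S σ → inS σ ≡ true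
  inS-true⁺ {σ} Sσ = dec-true (σ ∈Sl? Sl) (S⇒∈Sl Sσ)

  inB-true⁻ : ∀ {τ μ} → inB τ μ ≡ true → S μ × μ ⋖ τ
  inB-true⁻ {τ} {μ} e =
    let (inSμ , rest) = ∧-true⁻ {inS μ} e
        (μ⊆τ , size)  = ∧-true⁻ {does (μ ⊆? τ)} rest
    in inS-true⁻ inSμ , does⇒ (μ ⊆? τ) μ⊆τ , ≡ᵇ-true⁻ size

  inB-true⁺ : ∀ {τ μ} → S μ → μ ⋖ τ → inB τ μ ≡ true
  inB-true⁺ {τ} {μ} Sμ (μ⊆τ , size) =
    cong₂ _∧_ (inS-true⁺ Sμ) (cong₂ _∧_ (dec-true (μ ⊆? τ) μ⊆τ) (≡ᵇ-true⁺ size))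

  inδ-true⁻ : ∀ {σ μ} → S σ → inδ σ μ ≡ true → S μ × σ ⋖ μ
  inδ-true⁻ {σ} {μ} Sσ e =
    let (inSbarμ , rest) = ∧-true⁻ {inSbar μ} e
        (σ⊆μ , size)     = ∧-true⁻ {does (σ ⊆? μ)} rest
        (τ , τ∈Sl , μ⊆τ) = find (any⁻ _ Sl (Equivalence.from T-≡ inSbarμ))
    in convex Sσ (does⇒ (σ ⊆? μ) σ⊆μ) (does⇒ (μ ⊆? τ) (Equivalence.to T-≡ μ⊆τ)) (∈Sl⇒S τ∈Sl) ,
       does⇒ (σ ⊆? μ) σ⊆μ , sym (≡ᵇ-true⁻ size)

  inδ-true⁺ : ∀ {σ μ} → S μ → σ ⋖ μ → inδ σ μ ≡ true
  inδ-true⁺ {σ} {μ} Sμ (σ⊆μ , size) =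
    cong₂ _∧_ inSbarμ (cong₂ _∧_ (dec-true (σ ⊆? μ) σ⊆μ) (≡ᵇ-true⁺ (sym size)))
    where
    inSbarμ : inSbar μ ≡ true
    inSbarμ = Equivalence.to T-≡ (any⁺ _ (lose (S⇒∈Sl Sμ) (Equivalence.from T-≡ (dec-true (μ ⊆? μ) ⊆-refl))))

  inδ≡inB : ∀ {σ μ} → S σ → S μ → inδ σ μ ≡ inB μ σ
  inδ≡inB Sσ Sμ = ⇔→≡ (mk⇔ (λ e → inB-true⁺ Sσ (proj₂ (inδ-true⁻ Sσ e)))
                             (λ e → inδ-true⁺ Sμ (proj₂ (inB-true⁻ e))))

  Cur : State n → Fam n
  Cur s = C ∪ᶠ ⟦ T s ⟧

  missing : (Subset n → Bool) → Subset n → Subset n → Bool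
  missing marked τ μ = inB τ μ ∧ not (marked μ)

  record Invariant (s : State n) : Set where
    field
      T⊆S              : ∀ {μ} → T s μ ≡ true → S μ
      T-downward       : ∀ {μ ν} → T s ν ≡ true → S μ → μ ⊆ ν → T s μ ≡ true
      ρ≡#missing       : ∀ {τ} → S τ → ρ s τ ≡ countᵇ (missing (T s) τ) Sl
      U⊆S              : ∀ {τ} → U s τ ≡ true → S τ
      ρ≡1⇒U            : ∀ {τ} → S τ → T s τ ≡ false → ρ s τ ≡ 1 → U s τ ≡ true
      scanned          : List (Subset n)
      Sl≡scanned++rest : Sl ≡ scanned ++ rest s
      scanned⊆T        : All (λ μ → T s μ ≡ true) scanned

  module _ {s : State n} (inv : Invariant s) where
    open Invariant inv

    Cur-isComplex : IsComplex (Cur s)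
    Cur-isComplex = nonempty′ , closed′
      where
      nonempty′ : ∀ μ → Cur s μ → Nonempty μ
      nonempty′ μ (inj₁ Cμ) = proj₁ isComplex μ Cμ
      nonempty′ μ (inj₂ Tμ) = nonempty μ (T⊆S Tμ)
      closed′ : ∀ μ ν → Cur s ν → Nonempty μ → μ ⊆ ν → Cur s μ
      closed′ μ ν (inj₁ Cν) μ≠∅ μ⊆ν = inj₁ (proj₂ isComplex μ ν Cν μ≠∅ μ⊆ν)
      closed′ μ ν (inj₂ Tν) μ≠∅ μ⊆ν =
        Sum.map₂ (λ Sμ → T-downward Tν Sμ μ⊆ν) (faces μ ν (T⊆S Tν) μ≠∅ μ⊆ν)

    S∖T⊈Cur : ∀ {σ} → S σ → T s σ ≡ false → ¬ Cur s σ
    S∖T⊈Cur Sσ _  (inj₁ Cσ) = S∩C≡∅ Sσ Cσ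
    S∖T⊈Cur _  Tσ (inj₂ Tσ′) = not-¬ Tσ Tσ′

    Cur-complete : rest s ≡ [] → Cur s ≐ (C ∪ᶠ S)
    Cur-complete rest≡[] μ = mk⇔ (Sum.map₂ T⊆S) (Sum.map₂ scanned-marked)
      where
      scanned-marked : S μ → T s μ ≡ true
      scanned-marked Sμ
        with ∈-++⁻ scanned (subst (μ ∈L_) (trans Sl≡scanned++rest (cong (scanned ++_) rest≡[])) (S⇒∈Sl Sμ))
      ... | inj₁ μ∈scanned = All.lookup scanned⊆T μ∈scanned
      ... | inj₂ ()

  insert-true⁻ : ∀ {marked x μ} → insert marked x μ ≡ true → marked μ ≡ true ⊎ μ ≡ x
  insert-true⁻ {marked} {x} {μ} e = Sum.map₂ (does⇒ (μ ≟S x)) (∨-true⁻ {marked μ} e)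

  insert-false⁻ : ∀ {marked x μ} → insert marked x μ ≡ false → marked μ ≡ false × μ ≢ x
  insert-false⁻ {marked} {x} {μ} e with marked μ | μ ≟S x
  ... | false | no μ≢x = refl , μ≢x

  insert-old : ∀ marked x {μ} → marked μ ≡ true → insert marked x μ ≡ true
  insert-old marked x = ∨-trueˡ _

  insert-new : ∀ marked x → insert marked x x ≡ true
  insert-new marked x = ∨-trueʳ (marked x) (dec-true (x ≟S x) refl)

  ⟦insert⟧ : ∀ marked x → ⟦ insert marked x ⟧ ≐ (⟦ marked ⟧ ⊕ fill x)
  ⟦insert⟧ marked x μ =
    mk⇔ (insert-true⁻ {marked}) λ { (inj₁ old) → insert-old marked x old ; (inj₂ refl) → insert-new marked x }

  missing-insert : ∀ marked x τ μ → missing (insert marked x) τ μ ≡ (missing marked τ without x) μ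
  missing-insert marked x τ μ with inB τ μ | marked μ
  ... | true  | true  = refl
  ... | true  | false = refl
  ... | false | _     = refl

  ρ-insert : ∀ {marked ρ′ x} → (∀ {τ} → S τ → ρ′ τ ≡ countᵇ (missing marked τ) Sl) →
             S x → marked x ≡ false →
             ∀ {τ} → S τ → decr (inδ x) ρ′ τ ≡ countᵇ (missing (insert marked x) τ) Sl
  ρ-insert {marked} {ρ′} {x} ρ′≡#missing Sx x-unmarked {τ} Sτ with inδ x τ in x⋖τ
  ... | true = begin
    ρ′ τ ∸ 1
      ≡⟨ cong (_∸ 1) (ρ′≡#missing Sτ) ⟩
    countᵇ (missing marked τ) Sl ∸ 1
      ≡⟨ cong (_∸ 1) (countᵇ-without (missing marked τ) unique (S⇒∈Sl Sx) x-missing) ⟩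
    countᵇ (missing marked τ without x) Sl
      ≡⟨ countᵇ-cong Sl (λ _ → sym (missing-insert marked x τ _)) ⟩
    countᵇ (missing (insert marked x) τ) Sl
      ∎
    where
    x-missing : missing marked τ x ≡ true
    x-missing = cong₂ _∧_ (trans (sym (inδ≡inB Sx Sτ)) x⋖τ) (cong not x-unmarked)
  ... | false = begin
    ρ′ τ
      ≡⟨ ρ′≡#missing Sτ ⟩
    countᵇ (missing marked τ) Sl
      ≡⟨ countᵇ-cong Sl (λ _ → sym (without-false (missing marked τ) _ x-present)) ⟩
    countᵇ (missing marked τ without x) Sl
      ≡⟨ countᵇ-cong Sl (λ _ → sym (missing-insert marked x τ _)) ⟩
    countᵇ (missing (insert marked x) τ) Sl
      ∎
    where
    x-present : missing marked τ x ≡ false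
    x-present = cong (_∧ not (marked x)) (trans (sym (inδ≡inB Sx Sτ)) x⋖τ)

  decr-∨ : ∀ D E ρ′ μ → D μ ∧ E μ ≡ false →
           decr (λ ν → D ν ∨ E ν) ρ′ μ ≡ decr E (decr D ρ′) μ
  decr-∨ D E ρ′ μ ¬both with D μ | E μ
  ... | true  | false = refl
  ... | false | true  = refl
  ... | false | false = refl

  ρ≡1⇒addU : ∀ D ρ₀ U₀ {μ} → (ρ₀ μ ≡ 1 → U₀ μ ≡ true) →
             decr D ρ₀ μ ≡ 1 → addU D (decr D ρ₀) U₀ μ ≡ true
  ρ≡1⇒addU D ρ₀ U₀ {μ} old ρ′μ≡1 with D μ
  ... | true  = ∨-trueʳ (U₀ μ) (≡ᵇ-true⁺ ρ′μ≡1)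
  ... | false = ∨-trueˡ _ (old ρ′μ≡1)

  module PairStep {s : State n} (inv : Invariant s) {σ τ : Subset n}
                  (τ∈U : U s τ ≡ true) (ρτ≡1 : ρ s τ ≡ 1)
                  (σ∈∂τ : inB τ σ ≡ true) (σ∉T : T s σ ≡ false) where
    open Invariant inv

    Sτ : S τ
    Sτ = U⊆S τ∈U

    Sσ : S σ
    Sσ = proj₁ (inB-true⁻ σ∈∂τ)

    σ⋖τ : σ ⋖ τ
    σ⋖τ = proj₂ (inB-true⁻ σ∈∂τ)

    τ∉T : T s τ ≡ false
    τ∉T = ¬-not (λ τ∈T → not-¬ σ∉T (T-downward τ∈T Sσ (proj₁ σ⋖τ)))

    other-facets-marked : ∀ {κ} → S κ → κ ⋖ τ → κ ≢ σ → T s κ ≡ true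
    other-facets-marked {κ} Sκ κ⋖τ κ≢σ with T s κ in κ∉T
    ... | true  = refl
    ... | false = ⊥-elim (κ≢σ (countᵇ≡1⇒≡ unique (trans (sym (ρ≡#missing Sτ)) ρτ≡1)
                    (S⇒∈Sl Sκ) (S⇒∈Sl Sσ)
                    (cong₂ _∧_ (inB-true⁺ Sκ κ⋖τ) (cong not κ∉T)) (cong₂ _∧_ σ∈∂τ (cong not σ∉T))))

    -- A face of τ not containing σ lies in another facet of τ, and all those are marked.
    faces-of-τ : ∀ {μ} → S μ → μ ⊆ τ → T s μ ≡ true ⊎ μ ≡ σ ⊎ μ ≡ τ
    faces-of-τ {μ} Sμ μ⊆τ with σ ⊆? μ
    ... | yes σ⊆μ = inj₂ (⋖-between σ⋖τ σ⊆μ μ⊆τ)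
    ... | no  σ⊈μ with ⋖-avoiding σ⋖τ μ⊆τ σ⊈μ
    ...   | κ , κ⋖τ@(κ⊆τ , _) , μ⊆κ , κ≢σ =
      inj₁ (T-downward (other-facets-marked (convex Sμ μ⊆κ κ⊆τ Sτ) κ⋖τ κ≢σ) Sμ μ⊆κ)

    elemStep : ElemStep (Cur s) (pair σ τ)
    elemStep = pair-elemStep (Cur-isComplex inv) (S∖T⊈Cur inv Sσ σ∉T) (nonempty σ Sσ)
                             (⊆∧≢⇒⊂ (proj₁ σ⋖τ) (⋖⇒≢ σ⋖τ)) proper-faces
      where
      proper-faces : ∀ μ → Nonempty μ → μ ⊆ τ → μ ≢ σ → μ ≢ τ → Cur s μ
      proper-faces μ μ≠∅ μ⊆τ μ≢σ μ≢τ with faces μ τ Sτ μ≠∅ μ⊆τ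
      ... | inj₁ Cμ = inj₁ Cμ
      ... | inj₂ Sμ with faces-of-τ Sμ μ⊆τ
      ...   | inj₁ Tμ          = inj₂ Tμ
      ...   | inj₂ (inj₁ μ≡σ) = ⊥-elim (μ≢σ μ≡σ)
      ...   | inj₂ (inj₂ μ≡τ) = ⊥-elim (μ≢τ μ≡τ)

    s′ : State n
    s′ = doPair s σ τ

    marked′⁻ : ∀ {μ} → T s′ μ ≡ true → T s μ ≡ true ⊎ μ ≡ σ ⊎ μ ≡ τ
    marked′⁻ Tμ with insert-true⁻ {insert (T s) σ} Tμ
    ... | inj₁ Tμ′ = Sum.map₂ inj₁ (insert-true⁻ {T s} Tμ′)
    ... | inj₂ μ≡τ = inj₂ (inj₂ μ≡τ)

    marked′⁺ : ∀ {μ} → T s μ ≡ true ⊎ μ ≡ σ ⊎ μ ≡ τ → T s′ μ ≡ true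
    marked′⁺ (inj₁ Tμ)          = insert-old (insert (T s) σ) τ (insert-old (T s) σ Tμ)
    marked′⁺ (inj₂ (inj₁ refl)) = insert-old (insert (T s) σ) τ (insert-new (T s) σ)
    marked′⁺ (inj₂ (inj₂ refl)) = insert-new (insert (T s) σ) τ

    Cur-doPair : Cur s′ ≐ (Cur s ⊕ pair σ τ)
    Cur-doPair μ = mk⇔ (Sum.assocˡ ∘ Sum.map₂ marked′⁻) (Sum.map₂ marked′⁺ ∘ Sum.assocʳ)

    not-both-cofaces : ∀ ν → inδ σ ν ∧ inδ τ ν ≡ false
    not-both-cofaces ν = ¬-not λ both →
      let (σ⋖ν , τ⋖ν) = ∧-true⁻ {inδ σ ν} both
          ∣σ∣+1≡∣ν∣    = proj₂ (proj₂ (inδ-true⁻ Sσ σ⋖ν))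
          ∣τ∣+1≡∣ν∣    = proj₂ (proj₂ (inδ-true⁻ Sτ τ⋖ν))
      in 1+n≢n (trans (proj₂ σ⋖τ) (suc-injective (trans ∣τ∣+1≡∣ν∣ (sym ∣σ∣+1≡∣ν∣))))

    T⊆S′ : ∀ {μ} → T s′ μ ≡ true → S μ
    T⊆S′ Tμ with marked′⁻ Tμ
    ... | inj₁ Tμ′          = T⊆S Tμ′
    ... | inj₂ (inj₁ refl) = Sσ
    ... | inj₂ (inj₂ refl) = Sτ

    T-downward′ : ∀ {μ ν} → T s′ ν ≡ true → S μ → μ ⊆ ν → T s′ μ ≡ true
    T-downward′ Tν Sμ μ⊆ν with marked′⁻ Tν
    ... | inj₁ Tν′          = marked′⁺ (inj₁ (T-downward Tν′ Sμ μ⊆ν))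
    ... | inj₂ (inj₁ refl) = marked′⁺ (faces-of-τ Sμ (⊆-trans μ⊆ν (proj₁ σ⋖τ)))
    ... | inj₂ (inj₂ refl) = marked′⁺ (faces-of-τ Sμ μ⊆ν)

    ρ≡#missing′ : ∀ {ν} → S ν → ρ s′ ν ≡ countᵇ (missing (T s′) ν) Sl
    ρ≡#missing′ {ν} Sν = begin
      ρ s′ ν                                     ≡⟨ decr-∨ (inδ σ) (inδ τ) (ρ s) ν (not-both-cofaces ν) ⟩
      decr (inδ τ) (decr (inδ σ) (ρ s)) ν        ≡⟨ ρ-insert (ρ-insert ρ≡#missing Sσ σ∉T) Sτ τ∉T′ Sν ⟩
      countᵇ (missing (T s′) ν) Sl               ∎
      where
      τ∉T′ : insert (T s) σ τ ≡ false
      τ∉T′ = cong₂ _∨_ τ∉T (dec-false (τ ≟S σ) (⋖⇒≢ σ⋖τ ∘ sym))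

    U⊆S′ : ∀ {ν} → U s′ ν ≡ true → S ν
    U⊆S′ {ν} ν∈U with ∨-true⁻ {remove (U s) τ ν} ν∈U
    ... | inj₁ ν∈U′ = U⊆S (proj₁ (∧-true⁻ {U s ν} ν∈U′))
    ... | inj₂ new with ∨-true⁻ {inδ σ ν} (proj₁ (∧-true⁻ {inδ σ ν ∨ inδ τ ν} new))
    ...   | inj₁ σ⋖ν = proj₁ (inδ-true⁻ Sσ σ⋖ν)
    ...   | inj₂ τ⋖ν = proj₁ (inδ-true⁻ Sτ τ⋖ν)

    ρ≡1⇒U′ : ∀ {ν} → S ν → T s′ ν ≡ false → ρ s′ ν ≡ 1 → U s′ ν ≡ true
    ρ≡1⇒U′ {ν} Sν ν∉T′ = ρ≡1⇒addU (λ μ → inδ σ μ ∨ inδ τ μ) (ρ s) (remove (U s) τ) still-in-U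
      where
      still-in-U : ρ s ν ≡ 1 → remove (U s) τ ν ≡ true
      still-in-U ρν≡1 =
        let (ν∉T″ , ν≢τ) = insert-false⁻ {insert (T s) σ} ν∉T′
        in cong₂ _∧_ (ρ≡1⇒U Sν (proj₁ (insert-false⁻ {T s} ν∉T″)) ρν≡1)
                     (cong not (dec-false (ν ≟S τ) ν≢τ))

    invariant : Invariant s′
    invariant = record
      { T⊆S              = T⊆S′
      ; T-downward       = T-downward′
      ; ρ≡#missing       = ρ≡#missing′
      ; U⊆S              = U⊆S′
      ; ρ≡1⇒U            = ρ≡1⇒U′
      ; scanned          = scanned
      ; Sl≡scanned++rest = Sl≡scanned++rest
      ; scanned⊆T        = All.map (marked′⁺ ∘ inj₁) scanned⊆T
      }

  module FillStep {s : State n} (inv : Invariant s) {x : Subset n} {r : List (Subset n)}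
                  (rest≡x∷r : rest s ≡ x ∷ r) (x∉T : T s x ≡ false) where
    open Invariant inv

    Sl≡scanned++x∷r : Sl ≡ scanned ++ x ∷ r
    Sl≡scanned++x∷r = trans Sl≡scanned++rest (cong (scanned ++_) rest≡x∷r)

    Sx : S x
    Sx = ∈Sl⇒S (subst (x ∈L_) (sym Sl≡scanned++x∷r) (∈-++⁺ʳ scanned (here refl)))

    -- The enumeration is sorted by dimension, so a proper face of x precedes x and has been scanned.
    proper-faces-marked : ∀ {μ} → S μ → μ ⊆ x → μ ≢ x → T s μ ≡ true
    proper-faces-marked {μ} Sμ μ⊆x μ≢x with ∈-++⁻ scanned (subst (μ ∈L_) Sl≡scanned++x∷r (S⇒∈Sl Sμ))
    ... | inj₁ μ∈scanned  = All.lookup scanned⊆T μ∈scanned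
    ... | inj₂ (here μ≡x) = ⊥-elim (μ≢x μ≡x)
    ... | inj₂ (there μ∈r) = ⊥-elim (μ≢x (⊆∧∣≥∣⇒≡ μ⊆x (All.lookup ∣x∣≤ μ∈r)))
      where
      ∣x∣≤ : All (λ ν → ∣ x ∣ ≤ ∣ ν ∣) r
      ∣x∣≤ = AllPairs.head (AllPairs-dropˡ scanned (subst (AllPairs _) Sl≡scanned++x∷r sorted))

    faces-of-x : ∀ {μ} → S μ → μ ⊆ x → T s μ ≡ true ⊎ μ ≡ x
    faces-of-x {μ} Sμ μ⊆x with μ ≟S x
    ... | yes μ≡x = inj₂ μ≡x
    ... | no  μ≢x = inj₁ (proper-faces-marked Sμ μ⊆x μ≢x)

    elemStep : ElemStep (Cur s) (fill x)
    elemStep = fill-elemStep (Cur-isComplex inv) (S∖T⊈Cur inv Sx x∉T) (nonempty x Sx) proper-faces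
      where
      proper-faces : ∀ μ → Nonempty μ → μ ⊆ x → μ ≢ x → Cur s μ
      proper-faces μ μ≠∅ μ⊆x μ≢x =
        Sum.map₂ (λ Sμ → proper-faces-marked Sμ μ⊆x μ≢x) (faces μ x Sx μ≠∅ μ⊆x)

    s′ : State n
    s′ = doFill s x

    Cur-doFill : Cur s′ ≐ (Cur s ⊕ fill x)
    Cur-doFill μ = mk⇔ (Sum.assocˡ ∘ Sum.map₂ (Equivalence.to (⟦insert⟧ (T s) x μ)))
                       (Sum.map₂ (Equivalence.from (⟦insert⟧ (T s) x μ)) ∘ Sum.assocʳ)

    T⊆S′ : ∀ {μ} → T s′ μ ≡ true → S μ
    T⊆S′ Tμ with insert-true⁻ {T s} Tμ
    ... | inj₁ Tμ′ = T⊆S Tμ′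
    ... | inj₂ refl = Sx

    T-downward′ : ∀ {μ ν} → T s′ ν ≡ true → S μ → μ ⊆ ν → T s′ μ ≡ true
    T-downward′ {μ} Tν Sμ μ⊆ν with insert-true⁻ {T s} Tν
    ... | inj₁ Tν′ = insert-old (T s) x (T-downward Tν′ Sμ μ⊆ν)
    ... | inj₂ refl = Equivalence.from (⟦insert⟧ (T s) x μ) (faces-of-x Sμ μ⊆ν)

    U⊆S′ : ∀ {ν} → U s′ ν ≡ true → S ν
    U⊆S′ {ν} ν∈U with ∨-true⁻ {U s ν} ν∈U
    ... | inj₁ ν∈U′ = U⊆S ν∈U′
    ... | inj₂ new  = proj₁ (inδ-true⁻ Sx (proj₁ (∧-true⁻ {inδ x ν} new)))

    invariant : Invariant s′
    invariant = record
      { T⊆S              = T⊆S′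
      ; T-downward       = T-downward′
      ; ρ≡#missing       = ρ-insert ρ≡#missing Sx x∉T
      ; U⊆S              = U⊆S′
      ; ρ≡1⇒U            = λ Sν ν∉T′ →
                             ρ≡1⇒addU (inδ x) (ρ s) (U s) (ρ≡1⇒U Sν (proj₁ (insert-false⁻ {T s} ν∉T′)))
      ; scanned          = scanned
      ; Sl≡scanned++rest = Sl≡scanned++rest
      ; scanned⊆T        = All.map (insert-old (T s) x) scanned⊆T
      }

  -- A free pair (σ , τ) makes σ the only unmarked facet of τ, so τ would still be in U.
  no-free-pair : ∀ {s} → Invariant s → (∀ μ → U s μ ≡ false) →
                 ¬ ∃ λ σ → ∃ λ τ → S σ × S τ × constStack σ ≡ constStack τ × ElemStep (Cur s) (pair σ τ)
  no-free-pair {s} inv U≡∅ (σ , τ , Sσ , Sτ , _ , σ∉Cur , τ∉Cur , (_ , closed) , σ⊂τ , _ , Cur′τ , free) =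
    not-¬ (U≡∅ τ) (ρ≡1⇒U Sτ τ∉T (trans (ρ≡#missing Sτ) #missing≡1))
    where
    open Invariant inv

    σ≠∅ : Nonempty σ
    σ≠∅ = nonempty σ Sσ

    σ⋖τ : σ ⋖ τ
    σ⋖τ = ⊂∧no-between⇒⋖ σ⊂τ λ ν σ⊆ν ν⊆τ →
      free ν (closed ν τ Cur′τ (Product.map₂ σ⊆ν σ≠∅) ν⊆τ) σ⊆ν

    τ∉T : T s τ ≡ false
    τ∉T = ¬-not (τ∉Cur ∘ inj₂)

    only-σ-missing : ∀ {κ} → κ ∈L Sl → missing (T s) τ κ ≡ true → κ ≡ σ
    only-σ-missing κ∈Sl κ-missing with ∧-true⁻ κ-missing
    ... | κ∈∂τ , κ∉T with inB-true⁻ κ∈∂τ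
    ...   | Sκ , κ⋖τ@(κ⊆τ , _) with closed _ τ Cur′τ (nonempty _ Sκ) κ⊆τ
    ...     | inj₁ (inj₁ Cκ)  = ⊥-elim (S∩C≡∅ Sκ Cκ)
    ...     | inj₁ (inj₂ Tκ)  = ⊥-elim (not-¬ (not-injective κ∉T) Tκ)
    ...     | inj₂ (inj₁ κ≡σ) = κ≡σ
    ...     | inj₂ (inj₂ κ≡τ) = ⊥-elim (⋖⇒≢ κ⋖τ κ≡τ)

    #missing≡1 : countᵇ (missing (T s) τ) Sl ≡ 1
    #missing≡1 = countᵇ≡1 unique (S⇒∈Sl Sσ)
                   (cong₂ _∧_ (inB-true⁺ Sσ σ⋖τ) (cong not (¬-not (σ∉Cur ∘ inj₂)))) only-σ-missing

  Completes : State n → List (Step n) → Set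
  Completes s out = ∃ λ ws → out ≡ W s ++ ws × Steps (Cur s) ws (C ∪ᶠ S) × MaximalFrom S constStack (Cur s) ws

  Completes-step : ∀ {s s′ out} step → ElemStep (Cur s) step → Cur s′ ≐ (Cur s ⊕ step) →
                   W s′ ≡ W s ++ [ step ] →
                   (∀ {ws} → MaximalFrom S constStack (Cur s ⊕ step) ws →
                             MaximalFrom S constStack (Cur s) (step ∷ ws)) →
                   Completes s′ out → Completes s out
  Completes-step {s} step elem Cur′≐ W′≡ maximal-head (ws , out≡ , steps , maximal) =
    step ∷ ws , trans out≡ (trans (cong (_++ ws) W′≡) (++-assoc (W s) [ step ] ws)) ,
    (elem , Steps-congˡ ws Cur′≐ steps) , maximal-head (MaximalFrom-cong ws Cur′≐ maximal)

  dropU-invariant : ∀ {s τ} → Invariant s → ρ s τ ≢ 1 → Invariant (dropU s τ)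
  dropU-invariant {s} {τ} inv ρτ≢1 = record
    { T⊆S              = T⊆S
    ; T-downward       = T-downward
    ; ρ≡#missing       = ρ≡#missing
    ; U⊆S              = λ {ν} ν∈U → U⊆S (proj₁ (∧-true⁻ {U s ν} ν∈U))
    ; ρ≡1⇒U            = λ {ν} Sν ν∉T ρν≡1 →
        cong₂ _∧_ (ρ≡1⇒U Sν ν∉T ρν≡1) (cong not (dec-false (ν ≟S τ) λ { refl → ρτ≢1 ρν≡1 }))
    ; scanned          = scanned
    ; Sl≡scanned++rest = Sl≡scanned++rest
    ; scanned⊆T        = scanned⊆T
    }
    where open Invariant inv

  skip-invariant : ∀ {s x r} → Invariant s → rest s ≡ x ∷ r → T s x ≡ true → Invariant (record s { rest = r })
  skip-invariant {s} {x} {r} inv rest≡x∷r Tx = record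
    { T⊆S              = T⊆S
    ; T-downward       = T-downward
    ; ρ≡#missing       = ρ≡#missing
    ; U⊆S              = U⊆S
    ; ρ≡1⇒U            = ρ≡1⇒U
    ; scanned          = scanned ++ [ x ]
    ; Sl≡scanned++rest = trans Sl≡scanned++rest
                           (trans (cong (scanned ++_) rest≡x∷r) (sym (++-assoc scanned [ x ] r)))
    ; scanned⊆T        = All++⁺ scanned⊆T (Tx ∷ [])
    }
    where open Invariant inv

  HeadUnmarked : State n → Set
  HeadUnmarked s = ∀ {x r} → rest s ≡ x ∷ r → T s x ≡ false

  loop-completes : ∀ {s out} → Invariant s → Loop s out → Completes s out
  phA-completes  : ∀ {s out} → Invariant s → PhA s out → Completes s out
  phB-completes  : ∀ {s out} → Invariant s → (∀ μ → U s μ ≡ false) → PhB s out → Completes s out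
  phC-completes  : ∀ {s out} → Invariant s → (∀ μ → U s μ ≡ false) → HeadUnmarked s →
                   PhC s out → Completes s out

  loop-completes {s} inv (loop-exit rest≡[]) = [] , sym (++-identityʳ (W s)) , Cur-complete inv rest≡[] , _
  loop-completes inv (loop-go _ a)          = phA-completes inv a

  phA-completes inv (a-exit U≡∅ b)        = phB-completes inv U≡∅ b
  phA-completes inv (a-skip _ ρτ≢1 a)     = phA-completes (dropU-invariant inv ρτ≢1) a
  phA-completes inv (a-noeq _ _ _ _ F≢ _) = ⊥-elim (F≢ refl)
  phA-completes {s} inv (a-pair τ∈U ρτ≡1 σ∈∂τ σ∉T _ a) =
    Completes-step {s} {s′} (pair _ _) elemStep Cur-doPair refl (refl ,_) (phA-completes invariant a)
    where open PairStep inv τ∈U ρτ≡1 σ∈∂τ σ∉T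

  phB-completes inv U≡∅ (b-skip rest≡x∷r Tx b) = phB-completes (skip-invariant inv rest≡x∷r Tx) U≡∅ b
  phB-completes inv U≡∅ (b-end rest≡[] c) =
    phC-completes inv U≡∅ (λ rest≡x∷r → case trans (sym rest≡[]) rest≡x∷r of λ ()) c
  phB-completes {s} inv U≡∅ (b-stop rest≡x∷r x∉T c) = phC-completes inv U≡∅ head-unmarked c
    where
    head-unmarked : HeadUnmarked s
    head-unmarked rest≡y∷r′ =
      subst (λ y → T s y ≡ false) (∷-injectiveˡ (trans (sym rest≡x∷r) rest≡y∷r′)) x∉T

  phC-completes inv _   _             (c-none _ l)        = loop-completes inv l
  phC-completes {s} inv U≡∅ head-unmarked (c-fill rest≡x∷r l) =
    Completes-step {s} {s′} (fill _) elemStep Cur-doFill refl (no-free-pair inv U≡∅ ,_) (loop-completes invariant l)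
    where open FillStep inv rest≡x∷r (head-unmarked rest≡x∷r)

  initial-invariant : Invariant initial
  initial-invariant = record
    { T⊆S              = λ ()
    ; T-downward       = λ ()
    ; ρ≡#missing       = λ _ → countᵇ-cong Sl (λ _ → sym (∧-identityʳ _))
    ; U⊆S              = λ {τ} τ∈U → inS-true⁻ (proj₁ (∧-true⁻ {inS τ} τ∈U))
    ; ρ≡1⇒U            = λ Sτ _ ρτ≡1 → cong₂ _∧_ (inS-true⁺ Sτ) (≡ᵇ-true⁺ ρτ≡1)
    ; scanned          = []
    ; Sl≡scanned++rest = refl
    ; scanned⊆T        = []
    }

  Cur-initial : Cur initial ≐ C
  Cur-initial μ = mk⇔ (λ { (inj₁ Cμ) → Cμ ; (inj₂ ()) }) inj₁

  maxRun-correct : ∀ {out} → MaxRun out → Steps C out (C ∪ᶠ S) × MaximalFrom S constStack C out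
  maxRun-correct run with loop-completes initial-invariant run
  ... | ws , refl , steps , maximal = Steps-congˡ ws Cur-initial steps , MaximalFrom-cong ws Cur-initial maximal

record IsCosimplicial {n : ℕ} (S : Fam n) : Set where
  field
    nonempty : ∀ σ → S σ → Nonempty σ
    convex   : ∀ {σ μ τ} → S σ → σ ⊆ μ → μ ⊆ τ → S τ → S μ

module _ {n : ℕ} {S : Fam n} (S-cosimplicial : IsCosimplicial S) (S? : ∀ σ → Dec (S σ)) where
  open IsCosimplicial S-cosimplicial

  lowerClosure-extension : Extension (LowerClosure S) S
  lowerClosure-extension = record
    { isComplex     = (λ σ → proj₁ ∘ proj₁) , closed
    ; nonempty      = nonempty
    ; faces         = λ σ τ Sτ σ≠∅ σ⊆τ →
                        Sum.swap (Sum.map₂ (λ σ∉S → (σ≠∅ , τ , Sτ , σ⊆τ) , σ∉S) (Dec.toSum (S? σ)))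
    ; star-disjoint = λ σ μ Sσ σ⊆μ ((_ , τ , Sτ , μ⊆τ) , μ∉S) → μ∉S (convex Sσ σ⊆μ μ⊆τ Sτ)
    }
    where
    closed : ∀ σ τ → LowerClosure S τ → Nonempty σ → σ ⊆ τ → LowerClosure S σ
    closed σ τ ((_ , ν , Sν , τ⊆ν) , τ∉S) σ≠∅ σ⊆τ =
      (σ≠∅ , ν , Sν , ⊆-trans σ⊆τ τ⊆ν) , λ Sσ → τ∉S (convex Sσ σ⊆τ τ⊆ν Sν)

  lowerClosure-∪ : (LowerClosure S ∪ᶠ S) ≐ Closure S
  lowerClosure-∪ σ = mk⇔ (λ { (inj₁ (S̄σ , _)) → S̄σ ; (inj₂ Sσ) → S⊆Closure Sσ })
                         (λ S̄σ → Sum.swap (Sum.map₂ (S̄σ ,_) (Dec.toSum (S? σ))))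
    where
    S⊆Closure : S σ → Closure S σ
    S⊆Closure Sσ = nonempty σ Sσ , σ , Sσ , ⊆-refl

ValidEnum⇒Dec : ∀ {n} {F : Subset n → ℤ} {S : Fam n} {Sl} → ValidEnum F S Sl → ∀ σ → Dec (S σ)
ValidEnum⇒Dec {n} {Sl = Sl} (_ , ∈Sl⇔S , _) σ = Dec.map (∈Sl⇔S σ) (σ ∈Sl? Sl)
  where open DecMembership (_≟S_ {n}) using () renaming (_∈?_ to _∈Sl?_)

maxRun-maximalMorseSeqOn : ∀ {n} {S : Fam n} {Sl W} → IsCosimplicial S → ValidEnum constStack S Sl →
                           Procedure.MaxRun Sl constStack W → MaximalMorseSeqOn S constStack W
maxRun-maximalMorseSeqOn {S = S} {W = W} S-cosimplicial enum run =
  (Extension.isComplex extension , Steps-congʳ W (lowerClosure-∪ S-cosimplicial S?) steps) , maximal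
  where
  S? : ∀ σ → Dec (S σ)
  S? = ValidEnum⇒Dec enum
  extension : Extension (LowerClosure S) S
  extension = lowerClosure-extension S-cosimplicial S?
  open MaxCorrectness extension enum using (maxRun-correct)
  steps : Steps (LowerClosure S) W (LowerClosure S ∪ᶠ S)
  steps = proj₁ (maxRun-correct run)
  maximal : MaximalFrom S constStack (LowerClosure S) W
  maximal = proj₂ (maxRun-correct run)

foldr-⊔-upper : ∀ x xs {y} → y ∈L x ∷ xs → y ≤ℤ foldr _⊔_ x xs
foldr-⊔-upper x []       (here refl)         = ℤ.≤-refl
foldr-⊔-upper x (z ∷ zs) (here refl)         = ℤ.i≤j⇒i≤k⊔j z (foldr-⊔-upper x zs (here refl))
foldr-⊔-upper x (z ∷ zs) (there (here refl)) = ℤ.i≤i⊔j z _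
foldr-⊔-upper x (z ∷ zs) (there (there y∈))  = ℤ.i≤j⇒i≤k⊔j z (foldr-⊔-upper x zs (there y∈))

foldr-⊔-lub : ∀ x xs {b} → (∀ {y} → y ∈L x ∷ xs → y ≤ℤ b) → foldr _⊔_ x xs ≤ℤ b
foldr-⊔-lub x []       bound = bound (here refl)
foldr-⊔-lub x (z ∷ zs) bound =
  ℤ.⊔-lub (bound (there (here refl)))
          (foldr-⊔-lub x zs λ { (here refl) → bound (here refl) ; (there y∈) → bound (there (there y∈)) })

maxList≡just : ∀ {xs m} → m ∈L xs → (∀ {y} → y ∈L xs → y ≤ℤ m) → maxList xs ≡ just m
maxList≡just {x ∷ xs} m∈ bound = cong just (ℤ.≤-antisym (foldr-⊔-lub x xs bound) (foldr-⊔-upper x xs m∈))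

maxList≡just⇒upper : ∀ {xs m} → maxList xs ≡ just m → ∀ {y} → y ∈L xs → y ≤ℤ m
maxList≡just⇒upper {x ∷ xs} refl = foldr-⊔-upper x xs

x∈p⇒⁅x⁆⊆p : ∀ {n} {x : Fin n} {p} → x ∈ p → ⁅ x ⁆ ⊆ p
x∈p⇒⁅x⁆⊆p {x = x} {p} x∈p y∈⁅x⁆ = subst (_∈ p) (sym (x∈⁅y⁆⇒x≡y x y∈⁅x⁆)) x∈p

module LowerStars {n : ℕ} (K : Subset n → Bool) (K-complex : IsComplex ⟦ K ⟧) (f : Fin n → ℤ) where

  vertex-of : ∀ {τ w} → K τ ≡ true → w ∈ τ → IsVertex K w
  vertex-of {τ} {w} Kτ w∈τ = proj₂ K-complex ⁅ w ⁆ τ Kτ (w , x∈⁅x⁆ w) (x∈p⇒⁅x⁆⊆p w∈τ)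

  vertices : Subset n → List (Fin n)
  vertices τ = filterᵇ (λ v → does (v ∈? τ) ∧ K ⁅ v ⁆) (allFin n)

  ∈vertices⁺ : ∀ {τ w} → w ∈ τ → IsVertex K w → w ∈L vertices τ
  ∈vertices⁺ {τ} {w} w∈τ Kw =
    ∈-filter⁺ (T? ∘ λ v → does (v ∈? τ) ∧ K ⁅ v ⁆) (∈-allFin w)
              (Equivalence.from T-≡ (cong₂ _∧_ (dec-true (w ∈? τ) w∈τ) Kw))

  ∈vertices⁻ : ∀ {τ w} → w ∈L vertices τ → w ∈ τ
  ∈vertices⁻ {τ} {w} w∈ =
    let (_ , selected) = ∈-filter⁻ (T? ∘ λ v → does (v ∈? τ) ∧ K ⁅ v ⁆) {xs = allFin n} w∈
    in does⇒ (w ∈? τ) (proj₁ (∧-true⁻ (Equivalence.to T-≡ selected)))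

  inducedStack-vertex : ∀ {v} → IsVertex K v → inducedStack K f ⁅ v ⁆ ≡ just (f v)
  inducedStack-vertex {v} Kv = maxList≡just (∈-map⁺ f (∈vertices⁺ (x∈⁅x⁆ v) Kv)) bound
    where
    bound : ∀ {y} → y ∈L map f (vertices ⁅ v ⁆) → y ≤ℤ f v
    bound y∈ with ∈-map⁻ f y∈
    ... | w , w∈ , refl = ℤ.≤-reflexive (cong f (x∈⁅y⁆⇒x≡y v (∈vertices⁻ w∈)))

  LowerStar⇔ : ∀ {v τ} → LowerStar K f v τ ⇔ (K τ ≡ true × v ∈ τ × (∀ {w} → w ∈ τ → f w ≤ℤ f v))
  LowerStar⇔ {v} {τ} = mk⇔ to from
    where
    to : LowerStar K f v τ → K τ ≡ true × v ∈ τ × (∀ {w} → w ∈ τ → f w ≤ℤ f v)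
    to (Kτ , ⁅v⁆⊆τ , same-stack) =
      Kτ , v∈τ , λ w∈τ → maxList≡just⇒upper (trans same-stack (inducedStack-vertex (vertex-of Kτ v∈τ)))
                                              (∈-map⁺ f (∈vertices⁺ w∈τ (vertex-of Kτ w∈τ)))
      where
      v∈τ : v ∈ τ
      v∈τ = ⁅v⁆⊆τ (x∈⁅x⁆ v)
    from : K τ ≡ true × v ∈ τ × (∀ {w} → w ∈ τ → f w ≤ℤ f v) → LowerStar K f v τ
    from (Kτ , v∈τ , bound) =
      Kτ , x∈p⇒⁅x⁆⊆p v∈τ ,
      trans (maxList≡just (∈-map⁺ f (∈vertices⁺ v∈τ (vertex-of Kτ v∈τ))) bound′)
            (sym (inducedStack-vertex (vertex-of Kτ v∈τ)))
      where
      bound′ : ∀ {y} → y ∈L map f (vertices τ) → y ≤ℤ f v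
      bound′ y∈ with ∈-map⁻ f y∈
      ... | w , w∈ , refl = bound (∈vertices⁻ w∈)

  lowerStar-cosimplicial : ∀ v → IsCosimplicial (LowerStar K f v)
  lowerStar-cosimplicial v = record
    { nonempty = λ σ Sσ → v , proj₁ (proj₂ (Equivalence.to LowerStar⇔ Sσ))
    ; convex   = λ Sσ σ⊆μ μ⊆τ Sτ →
        let (_  , v∈σ , _)     = Equivalence.to LowerStar⇔ Sσ
            (Kτ , _   , bound) = Equivalence.to LowerStar⇔ Sτ
        in Equivalence.from LowerStar⇔
             (proj₂ K-complex _ _ Kτ (v , σ⊆μ v∈σ) μ⊆τ , σ⊆μ v∈σ , bound ∘ μ⊆τ)
    }

  Avoiding : List (Fin n) → Fam n
  Avoiding R τ = K τ ≡ true × (∀ {w} → w ∈ τ → ¬ w ∈L R)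

  Avoiding-complex : ∀ R → IsComplex (Avoiding R)
  Avoiding-complex R =
    (λ σ → proj₁ K-complex σ ∘ proj₁) ,
    (λ σ τ (Kτ , avoids) σ≠∅ σ⊆τ → proj₂ K-complex σ τ Kτ σ≠∅ σ⊆τ , avoids ∘ σ⊆τ)

  UpperSet : List (Fin n) → Set
  UpperSet R = ∀ {w r} → IsVertex K w → ¬ w ∈L R → r ∈L R → f w <ℤ f r

  module _ {v : Fin n} {R : List (Fin n)} (v<R : All (λ r → f v <ℤ f r) R) where

    below-v-avoids-R : ∀ {τ} → (∀ {w} → w ∈ τ → f w ≤ℤ f v) → ∀ {w} → w ∈ τ → ¬ w ∈L R
    below-v-avoids-R bound w∈τ w∈R = ℤ.≤⇒≯ (bound w∈τ) (All.lookup v<R w∈R)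

    lowerStar-extension : Extension (Avoiding (v ∷ R)) (LowerStar K f v)
    lowerStar-extension = record
      { isComplex     = Avoiding-complex (v ∷ R)
      ; nonempty      = IsCosimplicial.nonempty (lowerStar-cosimplicial v)
      ; faces         = faces
      ; star-disjoint = λ σ μ Sσ σ⊆μ (_ , avoids) →
                          avoids (σ⊆μ (proj₁ (proj₂ (Equivalence.to LowerStar⇔ Sσ)))) (here refl)
      }
      where
      faces : ∀ σ τ → LowerStar K f v τ → Nonempty σ → σ ⊆ τ → Avoiding (v ∷ R) σ ⊎ LowerStar K f v σ
      faces σ τ Sτ σ≠∅ σ⊆τ with Equivalence.to LowerStar⇔ Sτ | v ∈? σ
      ... | Kτ , _ , bound | yes v∈σ =
        inj₂ (Equivalence.from LowerStar⇔ (proj₂ K-complex σ τ Kτ σ≠∅ σ⊆τ , v∈σ , bound ∘ σ⊆τ))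
      ... | Kτ , _ , bound | no  v∉σ = inj₁ (proj₂ K-complex σ τ Kτ σ≠∅ σ⊆τ , avoids)
        where
        avoids : ∀ {w} → w ∈ σ → ¬ w ∈L v ∷ R
        avoids w∈σ (here refl)  = v∉σ w∈σ
        avoids w∈σ (there w∈R) = below-v-avoids-R bound (σ⊆τ w∈σ) w∈R

    module _ (upper : UpperSet (v ∷ R)) where

      UpperSet-tail : UpperSet R
      UpperSet-tail {w} Kw w∉R r∈R with w Fin.≟ v
      ... | yes refl = All.lookup v<R r∈R
      ... | no  w≢v  = upper Kw (λ { (here w≡v) → w≢v w≡v ; (there w∈R) → w∉R w∈R }) (there r∈R)

      Avoiding-∪-lowerStar : (Avoiding (v ∷ R) ∪ᶠ LowerStar K f v) ≐ Avoiding R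
      Avoiding-∪-lowerStar τ = mk⇔ to from
        where
        to : (Avoiding (v ∷ R) ∪ᶠ LowerStar K f v) τ → Avoiding R τ
        to (inj₁ (Kτ , avoids)) = Kτ , λ w∈τ → avoids w∈τ ∘ there
        to (inj₂ Sτ) = let (Kτ , _ , bound) = Equivalence.to LowerStar⇔ Sτ in Kτ , below-v-avoids-R bound
        from : Avoiding R τ → (Avoiding (v ∷ R) ∪ᶠ LowerStar K f v) τ
        from (Kτ , avoids) with v ∈? τ
        ... | yes v∈τ = inj₂ (Equivalence.from LowerStar⇔ (Kτ , v∈τ , bound))
          where
          bound : ∀ {w} → w ∈ τ → f w ≤ℤ f v
          bound {w} w∈τ with w Fin.≟ v
          ... | yes refl = ℤ.≤-refl
          ... | no  w≢v  = ℤ.<⇒≤ (upper (vertex-of Kτ w∈τ)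
                             (λ { (here w≡v) → w≢v w≡v ; (there w∈R) → avoids w∈τ w∈R }) (here refl))
        ... | no  v∉τ = inj₁ (Kτ , avoids′)
          where
          avoids′ : ∀ {w} → w ∈ τ → ¬ w ∈L v ∷ R
          avoids′ w∈τ (here refl)  = v∉τ w∈τ
          avoids′ w∈τ (there w∈R) = avoids w∈τ w∈R

  RunOn : Fin n → List (Subset n) × List (Step n) → Set
  RunOn v r = ValidEnum constStack (LowerStar K f v) (proj₁ r) × Procedure.MaxRun (proj₁ r) constStack (proj₂ r)

  concat-steps : ∀ R runs → AllPairs (λ a b → f a <ℤ f b) R → UpperSet R → Pointwise RunOn R runs →
                 Steps (Avoiding R) (concatMap proj₂ runs) ⟦ K ⟧
  concat-steps []      []                 []             _     []                      τ =
    mk⇔ proj₁ (λ Kτ → Kτ , λ {_} _ ())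
  concat-steps (v ∷ R) ((Sl , W) ∷ runs) (v<R ∷ sorted) upper ((enum , run) ∷ runs-ok) =
    Steps-++ W (concatMap proj₂ runs)
      (Steps-congʳ W (Avoiding-∪-lowerStar v<R upper) (proj₁ (maxRun-correct run)))
      (concat-steps R runs sorted (UpperSet-tail v<R upper) runs-ok)
    where open MaxCorrectness (lowerStar-extension v<R) enum using (maxRun-correct)

  Avoiding-all : ∀ {Vs} → (∀ v → (v ∈L Vs) ⇔ IsVertex K v) → Avoiding Vs ≐ ∅F
  Avoiding-all listed τ = mk⇔ (λ (Kτ , avoids) → let (w , w∈τ) = proj₁ K-complex τ Kτ in
                                  avoids w∈τ (Equivalence.from (listed w) (vertex-of Kτ w∈τ)))
                              λ ()

  UpperSet-all : ∀ {Vs} → (∀ v → (v ∈L Vs) ⇔ IsVertex K v) → UpperSet Vs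
  UpperSet-all listed {w} Kw w∉Vs _ = ⊥-elim (w∉Vs (Equivalence.from (listed w) Kw))

-- Injectivity of f on vertices already follows from the strictly increasing listing.
proposition8 : ∀ {n : ℕ} (K : Subset n → Bool) → IsComplex ⟦ K ⟧ →
    (f : Fin n → ℤ) → InjectiveOnVertices K f →
    (Vs : List (Fin n)) → VertexListing K f Vs →
    (runs : List (List (Subset n) × List (Step n))) →
    Pointwise (λ v r → ValidEnum constStack (LowerStar K f v) (proj₁ r)
                       × Procedure.MaxRun (proj₁ r) constStack (proj₂ r)) Vs runs →
    MorseSeqFrom ∅F (concatMap proj₂ runs) ⟦ K ⟧
    × Pointwise (λ v r → MaximalMorseSeqOn (LowerStar K f v) constStack (proj₂ r)) Vs runs
proposition8 K K-complex f _ Vs (listed , increasing) runs runs-ok =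
  (∅-isComplex , Steps-congˡ (concatMap proj₂ runs) (Avoiding-all listed)
                   (concat-steps Vs runs increasing (UpperSet-all listed) runs-ok)) ,
  Pointwise.map (λ (enum , run) → maxRun-maximalMorseSeqOn (lowerStar-cosimplicial _) enum run) runs-ok
  where open LowerStars K K-complex f
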